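{- Let $\mathbb{F}_4=\{0,1,\alpha,\alpha^2\}$ with $\alpha^2=\alpha+1$, $V=\mathbb{F}_4^{\,5}$, let $L$ be the line spanned by $(0,1,1,1,1)$ and $(1,0,1,\alpha,\alpha^2)$, and let $H_1: x_2+x_3+x_4+x_5=0$, $H_2: x_1+x_3+\alpha^2x_4+\alpha x_5=0$, $H_3: x_1+x_2+\alpha x_4+\alpha^2x_5=0$, $H_4: x_1+\alpha^2x_2+\alpha x_3+x_5=0$, $H_5: x_1+\alpha x_2+\alpha^2x_3+x_4=0$. Then every simplex line $L'$ which is not adjacent to $L$ in $\Gamma$ intersects the hyperplanes $H_1,\dots,H_5$ in mutually distinct points.
   Context: A vector of $V$ is a simplex vector if precisely one of its coordinates is zero. A point is a $1$-dimensional subspace; a simplex line is a $2$-dimensional subspace all of whose non-zero vectors are simplex vectors. $\Gamma$ is the graph whose vertices are all simplex lines, two distinct simplex lines being adjacent if their intersection is $1$-dimensional. -}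

module Defs where

open import Data.Nat using (ℕ)
open import Data.Fin using (Fin; zero; suc)
open import Data.Vec using (Vec; []; _∷_; map; zipWith; foldr; replicate; lookup)
open import Data.Product using (Σ; ∃; _×_; _,_)
open import Relation.Binary.PropositionalEquality using (_≡_; _≢_)
open import Relation.Nullary using (¬_)
open import Function.Bundles using (_⇔_)

data F4 : Set where
  𝟎 𝟏 α α² : F4

infixl 6 _+F_
infixl 7 _*F_

_+F_ : F4 → F4 → F4
𝟎  +F y  = y
x  +F 𝟎  = x
𝟏  +F 𝟏  = 𝟎
𝟏  +F α  = α²
𝟏  +F α² = α
α  +F 𝟏  = α²
α  +F α  = 𝟎
α  +F α² = 𝟏
α² +F 𝟏  = α
α² +F α  = 𝟏
α² +F α² = 𝟎

_*F_ : F4 → F4 → F4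
𝟎  *F y  = 𝟎
𝟏  *F y  = y
α  *F 𝟎  = 𝟎
α  *F 𝟏  = α
α  *F α  = α²
α  *F α² = 𝟏
α² *F 𝟎  = 𝟎
α² *F 𝟏  = α²
α² *F α  = 𝟏
α² *F α² = α

V : Set
V = Vec F4 5

𝟎V : V
𝟎V = replicate 5 𝟎

_+V_ : V → V → V
_+V_ = zipWith _+F_

_•_ : F4 → V → V
c • v = map (c *F_) v

Subset : Set₁
Subset = V → Set

SimplexVector : V → Set
SimplexVector w = Σ (Fin 5) λ i → (lookup w i ≡ 𝟎) × (∀ j → lookup w j ≡ 𝟎 → j ≡ i)

Span1 : V → Subset
Span1 p w = ∃ λ c → w ≡ c • p

Span2 : V → V → Subset
Span2 u v w = ∃ λ a → ∃ λ b → w ≡ (a • u) +V (b • v)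

LinIndep2 : V → V → Set
LinIndep2 u v = ∀ a b → (a • u) +V (b • v) ≡ 𝟎V → (a ≡ 𝟎) × (b ≡ 𝟎)

record Line : Set where
  constructor line
  field
    u v   : V
    indep : LinIndep2 u v

⟦_⟧ : Line → Subset
⟦ line u v _ ⟧ = Span2 u v

SimplexLine : Line → Set
SimplexLine L = ∀ w → ⟦ L ⟧ w → w ≢ 𝟎V → SimplexVector w

SameSubset : Subset → Subset → Set
SameSubset S T = ∀ w → S w ⇔ T w

_∩_ : Subset → Subset → Subset
(S ∩ T) w = S w × T w

IsPoint : Subset → V → Set
IsPoint S p = (p ≢ 𝟎V) × SameSubset S (Span1 p)

OneDim : Subset → Set
OneDim S = ∃ λ p → IsPoint S p

Adjacent : Subset → Subset → Set
Adjacent L L' = ¬ SameSubset L L' × OneDim (L ∩ L')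

dot : V → V → F4
dot h x = foldr (λ _ → F4) _+F_ 𝟎 (zipWith _*F_ h x)

Hyperplane : V → Subset
Hyperplane h x = dot h x ≡ 𝟎

u₀ v₀ : V
u₀ = 𝟎 ∷ 𝟏 ∷ 𝟏 ∷ 𝟏 ∷ 𝟏 ∷ []
v₀ = 𝟏 ∷ 𝟎 ∷ 𝟏 ∷ α ∷ α² ∷ []

L₀ : Subset
L₀ = Span2 u₀ v₀

hcoef : Fin 5 → V
hcoef zero                      = 𝟎 ∷ 𝟏  ∷ 𝟏  ∷ 𝟏  ∷ 𝟏  ∷ []
hcoef (suc zero)                = 𝟏 ∷ 𝟎  ∷ 𝟏  ∷ α² ∷ α  ∷ []
hcoef (suc (suc zero))          = 𝟏 ∷ 𝟏  ∷ 𝟎  ∷ α  ∷ α² ∷ []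
hcoef (suc (suc (suc zero)))    = 𝟏 ∷ α² ∷ α  ∷ 𝟎  ∷ 𝟏  ∷ []
hcoef (suc (suc (suc (suc zero)))) = 𝟏 ∷ α ∷ α² ∷ 𝟏 ∷ 𝟎 ∷ []

H : Fin 5 → Subset
H i = Hyperplane (hcoef i)

-- A simplex line L′ meets the hyperplanes x₁ = 0 and x₂ = 0 in nonzero vectors, which
-- rescale to (0,1,a,b,c) and (1,0,d,e,f); as no nonzero vector of L′ has two zero
-- coordinates, these two vectors span L′.  That leaves 4⁶ candidate lines.  For each one,
-- either it is not simplex, or it equals or is adjacent to L, or every trace L′ ∩ Hᵢ is a
-- point lying on no other Hⱼ (so the five points are distinct); which case holds is
-- decided by evaluation over F₄.

module Submission where

open import Defs
open import Data.Fin using (Fin; zero; suc)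
import Data.Fin.Properties as Fin
open import Data.Vec using (_∷_; []; lookup)
open import Data.Vec.Properties using (lookup-map; lookup-zipWith; lookup-replicate; map-id; ≡-dec)
open import Data.Vec.Relation.Binary.Pointwise.Extensional using (ext; Pointwise-≡⇒≡)
open import Data.Product using (∃; _×_; _,_; proj₁; proj₂)
open import Data.Product.Function.NonDependent.Propositional using (_×-⇔_)
open import Data.Sum using (inj₁; inj₂)
open import Data.Unit using (⊤)
open import Function using (_∘_)
open import Function.Bundles using (mk⇔; Equivalence)
open import Function.Construct.Composition using (_⇔-∘_)
open import Function.Construct.Identity using (⇔-id)
open import Function.Construct.Symmetry using (⇔-sym)
open import Relation.Binary.Definitions using (DecidableEquality)
open import Relation.Binary.PropositionalEquality
  using (_≡_; _≢_; refl; sym; trans; cong; cong₂; subst; module ≡-Reasoning)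
open import Relation.Nullary using (Dec; yes; no; ¬_; contradiction)
open import Relation.Nullary.Decidable using (_×-dec_; _⊎-dec_; _→-dec_; ¬?; map′; from-yes)
open import Relation.Unary using (Pred; Decidable; _⊆′_)

private
  variable
    S T R : Subset
    p u v : V

infix 4 _≟F_ _≟V_
infix 30 _⁻¹

_≟F_ : DecidableEquality F4
𝟎  ≟F 𝟎  = yes refl
𝟏  ≟F 𝟏  = yes refl
α  ≟F α  = yes refl
α² ≟F α² = yes refl
𝟎  ≟F 𝟏  = no λ ()
𝟎  ≟F α  = no λ ()
𝟎  ≟F α² = no λ ()
𝟏  ≟F 𝟎  = no λ ()
𝟏  ≟F α  = no λ ()
𝟏  ≟F α² = no λ ()
α  ≟F 𝟎  = no λ ()
α  ≟F 𝟏  = no λ ()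
α  ≟F α² = no λ ()
α² ≟F 𝟎  = no λ ()
α² ≟F 𝟏  = no λ ()
α² ≟F α  = no λ ()

module _ {ℓ} {P : Pred F4 ℓ} where

  ∀-F4 : P 𝟎 → P 𝟏 → P α → P α² → ∀ x → P x
  ∀-F4 p₀ _  _  _  𝟎  = p₀
  ∀-F4 _  p₁ _  _  𝟏  = p₁
  ∀-F4 _  _  p₂ _  α  = p₂
  ∀-F4 _  _  _  p₃ α² = p₃

  all?-F4 : Decidable P → Dec (∀ x → P x)
  all?-F4 P? = map′ (λ (p₀ , p₁ , p₂ , p₃) → ∀-F4 p₀ p₁ p₂ p₃)
                    (λ h → h 𝟎 , h 𝟏 , h α , h α²)
                    (P? 𝟎 ×-dec P? 𝟏 ×-dec P? α ×-dec P? α²)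

  any?-F4 : Decidable P → Dec (∃ P)
  any?-F4 P? = map′ (λ { (inj₁ p₀) → 𝟎 , p₀ ; (inj₂ (inj₁ p₁)) → 𝟏 , p₁
                       ; (inj₂ (inj₂ (inj₁ p₂))) → α , p₂ ; (inj₂ (inj₂ (inj₂ p₃))) → α² , p₃ })
                    (λ { (𝟎 , p₀) → inj₁ p₀ ; (𝟏 , p₁) → inj₂ (inj₁ p₁)
                       ; (α , p₂) → inj₂ (inj₂ (inj₁ p₂)) ; (α² , p₃) → inj₂ (inj₂ (inj₂ p₃)) })
                    (P? 𝟎 ⊎-dec P? 𝟏 ⊎-dec P? α ⊎-dec P? α²)

_⁻¹ : F4 → F4
𝟎 ⁻¹  = 𝟎
𝟏 ⁻¹  = 𝟏
α ⁻¹  = α²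
α² ⁻¹ = α

⁻¹-inverseˡ : ∀ x → x ≢ 𝟎 → x ⁻¹ *F x ≡ 𝟏
⁻¹-inverseˡ 𝟎  x≢𝟎 = contradiction refl x≢𝟎
⁻¹-inverseˡ 𝟏  _   = refl
⁻¹-inverseˡ α  _   = refl
⁻¹-inverseˡ α² _   = refl

+F-identityʳ : ∀ x → x +F 𝟎 ≡ x
+F-identityʳ = from-yes (all?-F4 λ x → x +F 𝟎 ≟F x)

*F-identityʳ : ∀ x → x *F 𝟏 ≡ x
*F-identityʳ = from-yes (all?-F4 λ x → x *F 𝟏 ≟F x)

*F-zeroʳ : ∀ x → x *F 𝟎 ≡ 𝟎
*F-zeroʳ = from-yes (all?-F4 λ x → x *F 𝟎 ≟F 𝟎)

*F-assoc : ∀ x y z → (x *F y) *F z ≡ x *F (y *F z)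
*F-assoc = from-yes (all?-F4 λ x → all?-F4 λ y → all?-F4 λ z → (x *F y) *F z ≟F x *F (y *F z))

+F-self : ∀ x → x +F x ≡ 𝟎
+F-self = from-yes (all?-F4 λ x → x +F x ≟F 𝟎)

+F≡𝟎⇒≡ : ∀ x y → x +F y ≡ 𝟎 → x ≡ y
+F≡𝟎⇒≡ = from-yes (all?-F4 λ x → all?-F4 λ y → x +F y ≟F 𝟎 →-dec x ≟F y)

*F-distrib-comb : ∀ c a b x y → c *F (a *F x +F b *F y) ≡ (c *F a) *F x +F (c *F b) *F y
*F-distrib-comb = from-yes (all?-F4 λ c → all?-F4 λ a → all?-F4 λ b → all?-F4 λ x → all?-F4 λ y →
  c *F (a *F x +F b *F y) ≟F (c *F a) *F x +F (c *F b) *F y)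

comb-+F-comb : ∀ a b a′ b′ x y →
  (a *F x +F b *F y) +F (a′ *F x +F b′ *F y) ≡ (a +F a′) *F x +F (b +F b′) *F y
comb-+F-comb = from-yes (all?-F4 λ a → all?-F4 λ b → all?-F4 λ a′ → all?-F4 λ b′ → all?-F4 λ x → all?-F4 λ y →
  (a *F x +F b *F y) +F (a′ *F x +F b′ *F y) ≟F (a +F a′) *F x +F (b +F b′) *F y)

_≟V_ : DecidableEquality V
_≟V_ = ≡-dec _≟F_

lin : F4 → F4 → V → V → V
lin a b u v = (a • u) +V (b • v)

V-ext : ∀ {x y : V} → (∀ i → lookup x i ≡ lookup y i) → x ≡ y
V-ext = Pointwise-≡⇒≡ ∘ ext

lookup-+V : ∀ (x y : V) i → lookup (x +V y) i ≡ lookup x i +F lookup y i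
lookup-+V x y i = lookup-zipWith _+F_ i x y

lookup-lin : ∀ a b u v i → lookup (lin a b u v) i ≡ a *F lookup u i +F b *F lookup v i
lookup-lin a b u v i = trans (lookup-+V (a • u) (b • v) i)
                             (cong₂ _+F_ (lookup-map i (a *F_) u) (lookup-map i (b *F_) v))

+V≡𝟎V⇒≡ : ∀ {x y : V} → x +V y ≡ 𝟎V → x ≡ y
+V≡𝟎V⇒≡ {x} {y} x+y≡𝟎 = V-ext λ i → +F≡𝟎⇒≡ _ _ (begin
  lookup x i +F lookup y i  ≡⟨ lookup-+V x y i ⟨
  lookup (x +V y) i         ≡⟨ cong (λ z → lookup z i) x+y≡𝟎 ⟩
  lookup 𝟎V i               ≡⟨ lookup-replicate i 𝟎 ⟩
  𝟎                         ∎)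
  where open ≡-Reasoning

lin-𝟏-𝟎 : lin 𝟏 𝟎 u v ≡ u
lin-𝟏-𝟎 {u} {v} = V-ext λ i → trans (lookup-lin 𝟏 𝟎 u v i) (+F-identityʳ (lookup u i))

Span2-left : Span2 u v u
Span2-left = 𝟏 , 𝟎 , sym lin-𝟏-𝟎

Span2-• : ∀ c {x} → Span2 u v x → Span2 u v (c • x)
Span2-• {u} {v} c (a , b , refl) = c *F a , c *F b , V-ext λ i → begin
  lookup (c • lin a b u v) i                        ≡⟨ lookup-map i (c *F_) (lin a b u v) ⟩
  c *F lookup (lin a b u v) i                       ≡⟨ cong (c *F_) (lookup-lin a b u v i) ⟩
  c *F (a *F lookup u i +F b *F lookup v i)          ≡⟨ *F-distrib-comb c a b _ _ ⟩
  (c *F a) *F lookup u i +F (c *F b) *F lookup v i   ≡⟨ lookup-lin (c *F a) (c *F b) u v i ⟨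
  lookup (lin (c *F a) (c *F b) u v) i              ∎
  where open ≡-Reasoning

Span2-+V : ∀ {x y} → Span2 u v x → Span2 u v y → Span2 u v (x +V y)
Span2-+V {u} {v} (a , b , refl) (a′ , b′ , refl) = a +F a′ , b +F b′ , V-ext λ i → begin
  lookup (lin a b u v +V lin a′ b′ u v) i             ≡⟨ lookup-+V (lin a b u v) (lin a′ b′ u v) i ⟩
  lookup (lin a b u v) i +F lookup (lin a′ b′ u v) i  ≡⟨ cong₂ _+F_ (lookup-lin a b u v i) (lookup-lin a′ b′ u v i) ⟩
  (a *F lookup u i +F b *F lookup v i) +F (a′ *F lookup u i +F b′ *F lookup v i)
                                                      ≡⟨ comb-+F-comb a b a′ b′ _ _ ⟩
  (a +F a′) *F lookup u i +F (b +F b′) *F lookup v i  ≡⟨ lookup-lin (a +F a′) (b +F b′) u v i ⟨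
  lookup (lin (a +F a′) (b +F b′) u v) i              ∎
  where open ≡-Reasoning

Span2-lin : ∀ {x y} a b → Span2 u v x → Span2 u v y → Span2 u v (lin a b x y)
Span2-lin a b x∈ y∈ = Span2-+V (Span2-• a x∈) (Span2-• b y∈)

SimplexOrZero : Subset
SimplexOrZero w = w ≢ 𝟎V → SimplexVector w

SimplexVector-zeros-unique : ∀ {w i j} → SimplexVector w → lookup w i ≡ 𝟎 → lookup w j ≡ 𝟎 → i ≡ j
SimplexVector-zeros-unique (_ , _ , unique) wᵢ≡𝟎 wⱼ≡𝟎 = trans (unique _ wᵢ≡𝟎) (sym (unique _ wⱼ≡𝟎))

LinIndep2⇒∃-zero-at : LinIndep2 u v → ∀ k → ∃ λ x → Span2 u v x × x ≢ 𝟎V × lookup x k ≡ 𝟎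
LinIndep2⇒∃-zero-at {u} {v} indep k with lookup u k ≟F 𝟎
... | yes uₖ≡𝟎 = u , Span2-left , u≢𝟎 , uₖ≡𝟎
  where
  u≢𝟎 : u ≢ 𝟎V
  u≢𝟎 u≡𝟎 with () ← proj₁ (indep 𝟏 𝟎 (trans lin-𝟏-𝟎 u≡𝟎))
... | no uₖ≢𝟎 = lin c 𝟏 u v , (c , 𝟏 , refl) , x≢𝟎 , xₖ≡𝟎
  where
  uₖ vₖ c : F4
  uₖ = lookup u k
  vₖ = lookup v k
  c = vₖ *F uₖ ⁻¹
  x≢𝟎 : lin c 𝟏 u v ≢ 𝟎V
  x≢𝟎 x≡𝟎 with () ← proj₂ (indep c 𝟏 x≡𝟎)
  xₖ≡𝟎 : lookup (lin c 𝟏 u v) k ≡ 𝟎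
  xₖ≡𝟎 = begin
    lookup (lin c 𝟏 u v) k      ≡⟨ lookup-lin c 𝟏 u v k ⟩
    (vₖ *F uₖ ⁻¹) *F uₖ +F vₖ   ≡⟨ cong (_+F vₖ) (*F-assoc vₖ (uₖ ⁻¹) uₖ) ⟩
    vₖ *F (uₖ ⁻¹ *F uₖ) +F vₖ   ≡⟨ cong (λ y → vₖ *F y +F vₖ) (⁻¹-inverseˡ uₖ uₖ≢𝟎) ⟩
    vₖ *F 𝟏 +F vₖ               ≡⟨ cong (_+F vₖ) (*F-identityʳ vₖ) ⟩
    vₖ +F vₖ                    ≡⟨ +F-self vₖ ⟩
    𝟎                           ∎
    where open ≡-Reasoning

Span2-normalise : Span2 u v ⊆′ SimplexOrZero → ∀ {x k l} → Span2 u v x → x ≢ 𝟎V →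
                  lookup x k ≡ 𝟎 → k ≢ l → ∃ λ y → Span2 u v y × lookup y k ≡ 𝟎 × lookup y l ≡ 𝟏
Span2-normalise simplex {x} {k} {l} x∈ x≢𝟎 xₖ≡𝟎 k≢l = xₗ ⁻¹ • x , Span2-• (xₗ ⁻¹) x∈ , yₖ≡𝟎 , yₗ≡𝟏
  where
  xₗ : F4
  xₗ = lookup x l
  xₗ≢𝟎 : xₗ ≢ 𝟎
  xₗ≢𝟎 xₗ≡𝟎 = k≢l (SimplexVector-zeros-unique {x} (simplex x x∈ x≢𝟎) xₖ≡𝟎 xₗ≡𝟎)
  yₖ≡𝟎 : lookup (xₗ ⁻¹ • x) k ≡ 𝟎
  yₖ≡𝟎 = trans (lookup-map k (xₗ ⁻¹ *F_) x) (trans (cong (xₗ ⁻¹ *F_) xₖ≡𝟎) (*F-zeroʳ (xₗ ⁻¹)))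
  yₗ≡𝟏 : lookup (xₗ ⁻¹ • x) l ≡ 𝟏
  yₗ≡𝟏 = trans (lookup-map l (xₗ ⁻¹ *F_) x) (⁻¹-inverseˡ xₗ xₗ≢𝟎)

Span2-∋-normalised : LinIndep2 u v → Span2 u v ⊆′ SimplexOrZero → ∀ k l → k ≢ l →
                     ∃ λ y → Span2 u v y × lookup y k ≡ 𝟎 × lookup y l ≡ 𝟏
Span2-∋-normalised indep simplex k l k≢l =
  let x , x∈ , x≢𝟎 , xₖ≡𝟎 = LinIndep2⇒∃-zero-at indep k
  in Span2-normalise simplex x∈ x≢𝟎 xₖ≡𝟎 k≢l

basis₁ basis₂ : F4 → F4 → F4 → V
basis₁ a b c = 𝟎 ∷ 𝟏 ∷ a ∷ b ∷ c ∷ []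
basis₂ a b c = 𝟏 ∷ 𝟎 ∷ a ∷ b ∷ c ∷ []

basis₁-shape : ∀ (y : V) → lookup y zero ≡ 𝟎 → lookup y (suc zero) ≡ 𝟏 →
               ∃ λ a → ∃ λ b → ∃ λ c → y ≡ basis₁ a b c
basis₁-shape (_ ∷ _ ∷ a ∷ b ∷ c ∷ []) refl refl = a , b , c , refl

basis₂-shape : ∀ (y : V) → lookup y zero ≡ 𝟏 → lookup y (suc zero) ≡ 𝟎 →
               ∃ λ a → ∃ λ b → ∃ λ c → y ≡ basis₂ a b c
basis₂-shape (_ ∷ _ ∷ a ∷ b ∷ c ∷ []) refl refl = a , b , c , refl

module _ {a b c d e f : F4} where

  private
    w₁ w₂ : V
    w₁ = basis₁ a b c
    w₂ = basis₂ d e f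

  lookup₀-lin-basis : ∀ s t → lookup (lin s t w₁ w₂) zero ≡ t
  lookup₀-lin-basis s t = cong₂ _+F_ (*F-zeroʳ s) (*F-identityʳ t)

  lookup₁-lin-basis : ∀ s t → lookup (lin s t w₁ w₂) (suc zero) ≡ s
  lookup₁-lin-basis s t = trans (cong₂ _+F_ (*F-identityʳ s) (*F-zeroʳ t)) (+F-identityʳ s)

  Span2-basis-coordinates : ∀ {z} → Span2 w₁ w₂ z → z ≡ lin (lookup z (suc zero)) (lookup z zero) w₁ w₂
  Span2-basis-coordinates (s , t , refl) =
    sym (cong₂ (λ s′ t′ → lin s′ t′ w₁ w₂) (lookup₁-lin-basis s t) (lookup₀-lin-basis s t))

  Span2-basis? : Decidable (Span2 w₁ w₂)
  Span2-basis? z = map′ (λ z≡ → lookup z (suc zero) , lookup z zero , z≡) Span2-basis-coordinates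
                        (z ≟V lin (lookup z (suc zero)) (lookup z zero) w₁ w₂)

  -- z and its would-be expansion agree in the first two coordinates, so their
  -- difference (a sum, in characteristic 2) is a vector of the line with two zeros.
  Span2-coordinates : Span2 u v ⊆′ SimplexOrZero → Span2 u v w₁ → Span2 u v w₂ →
                      ∀ {z} → Span2 u v z → z ≡ lin (lookup z (suc zero)) (lookup z zero) w₁ w₂
  Span2-coordinates simplex w₁∈ w₂∈ {z} z∈ = +V≡𝟎V⇒≡ r≡𝟎
    where
    z₀ z₁ : F4
    z₀ = lookup z zero
    z₁ = lookup z (suc zero)
    r : V
    r = z +V lin z₁ z₀ w₁ w₂
    r₀≡𝟎 : lookup r zero ≡ 𝟎
    r₀≡𝟎 = trans (lookup-+V z (lin z₁ z₀ w₁ w₂) zero)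
                 (trans (cong (z₀ +F_) (lookup₀-lin-basis z₁ z₀)) (+F-self z₀))
    r₁≡𝟎 : lookup r (suc zero) ≡ 𝟎
    r₁≡𝟎 = trans (lookup-+V z (lin z₁ z₀ w₁ w₂) (suc zero))
                 (trans (cong (z₁ +F_) (lookup₁-lin-basis z₁ z₀)) (+F-self z₁))
    r≡𝟎 : r ≡ 𝟎V
    r≡𝟎 with r ≟V 𝟎V
    ... | yes r≡𝟎 = r≡𝟎
    ... | no r≢𝟎 with () ← SimplexVector-zeros-unique {r}
                             (simplex r (Span2-+V z∈ (Span2-lin z₁ z₀ w₁∈ w₂∈)) r≢𝟎) r₀≡𝟎 r₁≡𝟎

  Span2-≐-basis : Span2 u v ⊆′ SimplexOrZero → Span2 u v w₁ → Span2 u v w₂ →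
                  SameSubset (Span2 u v) (Span2 w₁ w₂)
  Span2-≐-basis simplex w₁∈ w₂∈ z =
    mk⇔ (λ z∈ → lookup z (suc zero) , lookup z zero , Span2-coordinates simplex w₁∈ w₂∈ z∈)
        λ { (s , t , refl) → Span2-lin s t w₁∈ w₂∈ }

canonical-basis : ∀ L → SimplexLine L → ∃ λ a → ∃ λ b → ∃ λ c → ∃ λ d → ∃ λ e → ∃ λ f →
                  SameSubset ⟦ L ⟧ (Span2 (basis₁ a b c) (basis₂ d e f))
canonical-basis (line u v indep) simplex =
  let y , y∈ , y₀≡𝟎 , y₁≡𝟏 = Span2-∋-normalised indep simplex zero (suc zero) λ ()
      y′ , y′∈ , y′₁≡𝟎 , y′₀≡𝟏 = Span2-∋-normalised indep simplex (suc zero) zero λ ()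
      a , b , c , y≡ = basis₁-shape y y₀≡𝟎 y₁≡𝟏
      d , e , f , y′≡ = basis₂-shape y′ y′₀≡𝟏 y′₁≡𝟎
  in a , b , c , d , e , f ,
     Span2-≐-basis simplex (subst (Span2 u v) y≡ y∈) (subst (Span2 u v) y′≡ y′∈)

SameSubset-sym : SameSubset S T → SameSubset T S
SameSubset-sym S≐T w = ⇔-sym (S≐T w)

SameSubset-trans : SameSubset S T → SameSubset T R → SameSubset S R
SameSubset-trans S≐T T≐R w = T≐R w ⇔-∘ S≐T w

∩-congˡ : SameSubset S T → SameSubset (S ∩ R) (T ∩ R)
∩-congˡ {R = R} S≐T w = S≐T w ×-⇔ ⇔-id (R w)

∩-congʳ : SameSubset S T → SameSubset (R ∩ S) (R ∩ T)
∩-congʳ {R = R} S≐T w = ⇔-id (R w) ×-⇔ S≐T w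

IsPoint-cong : SameSubset S T → IsPoint S p → IsPoint T p
IsPoint-cong S≐T (p≢𝟎 , S≐p) = p≢𝟎 , SameSubset-trans (SameSubset-sym S≐T) S≐p

OneDim-cong : SameSubset S T → OneDim S → OneDim T
OneDim-cong S≐T (p , S-point) = p , IsPoint-cong S≐T S-point

Adjacent-congʳ : SameSubset S T → Adjacent R S → Adjacent R T
Adjacent-congʳ S≐T (R≠S , R∩S-point) =
  (λ R≐T → R≠S (SameSubset-trans R≐T (SameSubset-sym S≐T))) , OneDim-cong (∩-congʳ S≐T) R∩S-point

Span1-refl : Span1 p p
Span1-refl {p} = 𝟏 , sym (map-id p)

SeparatedTraces : Subset → Set
SeparatedTraces S = ∀ i → ∃ λ p → IsPoint (S ∩ H i) p × (∀ j → j ≢ i → ¬ H j p)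

SeparatedTraces-cong : SameSubset S T → SeparatedTraces S → SeparatedTraces T
SeparatedTraces-cong S≐T traces i =
  let p , point , apart = traces i in p , IsPoint-cong (∩-congˡ S≐T) point , apart

SeparatedTraces⇒distinct-points : SeparatedTraces S →
  ∃ λ (p : Fin 5 → V) → (∀ i → IsPoint (S ∩ H i) (p i)) ×
                        (∀ i j → i ≢ j → ¬ SameSubset (Span1 (p i)) (Span1 (p j)))
SeparatedTraces⇒distinct-points traces = q , proj₁ ∘ proj₂ ∘ traces , distinct
  where
  q : Fin 5 → V
  q = proj₁ ∘ traces
  distinct : ∀ i j → i ≢ j → ¬ SameSubset (Span1 (q i)) (Span1 (q j))
  distinct i j i≢j qᵢ≐qⱼ =
    let _ , (_ , Sⱼ≐qⱼ) , _ = traces j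
        _ , qᵢ∈Hⱼ = Equivalence.from (Sⱼ≐qⱼ (q i)) (Equivalence.to (qᵢ≐qⱼ (q i)) Span1-refl)
    in proj₂ (proj₂ (traces i)) j (i≢j ∘ sym) qᵢ∈Hⱼ

SimplexVector? : Decidable SimplexVector
SimplexVector? w = Fin.any? λ i → lookup w i ≟F 𝟎 ×-dec Fin.all? λ j → lookup w j ≟F 𝟎 →-dec j Fin.≟ i

SimplexOrZero? : Decidable SimplexOrZero
SimplexOrZero? w = ¬? (w ≟V 𝟎V) →-dec SimplexVector? w

Hyperplane? : ∀ h → Decidable (Hyperplane h)
Hyperplane? h x = dot h x ≟F 𝟎

Span1? : ∀ p → Decidable (Span1 p)
Span1? p w = any?-F4 λ c → w ≟V c • p

Span1-⊆′? : ∀ p → Decidable T → Dec (Span1 p ⊆′ T)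
Span1-⊆′? p T? = map′ (λ { T∋cp _ (c , refl) → T∋cp c }) (λ p⊆T c → p⊆T (c • p) (c , refl))
                      (all?-F4 λ c → T? (c • p))

Span2-⊆′? : ∀ u v → Decidable T → Dec (Span2 u v ⊆′ T)
Span2-⊆′? u v T? = map′ (λ { T∋lin _ (a , b , refl) → T∋lin a b })
                        (λ uv⊆T a b → uv⊆T (lin a b u v) (a , b , refl))
                        (all?-F4 λ a → all?-F4 λ b → T? (lin a b u v))

Span2∩-⊆′? : ∀ u v → Decidable T → Decidable R → Dec ((Span2 u v ∩ T) ⊆′ R)
Span2∩-⊆′? u v T? R? = map′ (λ uv⊆T⇒R w (w∈uv , w∈T) → uv⊆T⇒R w w∈uv w∈T)
                            (λ uv∩T⊆R w w∈uv w∈T → uv∩T⊆R w (w∈uv , w∈T))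
                            (Span2-⊆′? u v λ w → T? w →-dec R? w)

SameSubset? : Dec (S ⊆′ T) → Dec (T ⊆′ S) → Dec (SameSubset S T)
SameSubset? S⊆T? T⊆S? = map′ (λ (S⊆T , T⊆S) w → mk⇔ (S⊆T w) (T⊆S w))
                             (λ S≐T → (λ w → Equivalence.to (S≐T w)) , (λ w → Equivalence.from (S≐T w)))
                             (S⊆T? ×-dec T⊆S?)

module _ (u v : V) (uv? : Decidable (Span2 u v)) (T? : Decidable T) where

  -- Span1 p ⊆ … is tested first: it fails at once for the many p outside T.
  IsPoint? : ∀ p → Dec (IsPoint (Span2 u v ∩ T) p)
  IsPoint? p = ¬? (p ≟V 𝟎V) ×-dec map′ SameSubset-sym SameSubset-sym
                                     (SameSubset? (Span1-⊆′? p λ w → uv? w ×-dec T? w)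
                                                  (Span2∩-⊆′? u v T? (Span1? p)))

  -- A generator of Span2 u v ∩ T lies in Span2 u v, so only its 16 vectors need to be tried.
  ∃-point? : ∀ {P : Subset} → Decidable P → Dec (∃ λ p → IsPoint (Span2 u v ∩ T) p × P p)
  ∃-point? {P} P? = map′ (λ (a , b , point) → lin a b u v , point) generator-in-span
                         (any?-F4 λ a → any?-F4 λ b → IsPoint? (lin a b u v) ×-dec P? (lin a b u v))
    where
    generator-in-span : ∃ (λ p → IsPoint (Span2 u v ∩ T) p × P p) →
                        ∃ λ a → ∃ λ b → IsPoint (Span2 u v ∩ T) (lin a b u v) × P (lin a b u v)
    generator-in-span (p , point@(_ , X≐p) , Pp) =
      let (a , b , p≡lin) , _ = Equivalence.from (X≐p p) Span1-refl
      in a , b , subst (λ q → IsPoint (Span2 u v ∩ T) q × P q) p≡lin (point , Pp)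

  OneDim? : Dec (OneDim (Span2 u v ∩ T))
  OneDim? = map′ (λ (p , point , _) → p , point) (λ (p , point) → p , point , _)
                 (∃-point? {λ _ → ⊤} λ _ → yes _)

SameSubset-Span2? : ∀ u v u′ v′ → Decidable (Span2 u v) → Decidable (Span2 u′ v′) →
                    Dec (SameSubset (Span2 u v) (Span2 u′ v′))
SameSubset-Span2? u v u′ v′ uv? u′v′? = SameSubset? (Span2-⊆′? u v u′v′?) (Span2-⊆′? u′ v′ uv?)

Adjacent? : ∀ u v u′ v′ → Decidable (Span2 u v) → Decidable (Span2 u′ v′) →
            Dec (Adjacent (Span2 u v) (Span2 u′ v′))
Adjacent? u v u′ v′ uv? u′v′? = ¬? (SameSubset-Span2? u v u′ v′ uv? u′v′?) ×-dec OneDim? u v uv? u′v′?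

SeparatedTraces? : ∀ u v → Decidable (Span2 u v) → Dec (SeparatedTraces (Span2 u v))
SeparatedTraces? u v uv? = Fin.all? λ i → ∃-point? u v uv? (Hyperplane? (hcoef i))
  λ p → Fin.all? λ j → ¬? (j Fin.≟ i) →-dec ¬? (Hyperplane? (hcoef j) p)

L₀? : Decidable L₀
L₀? = Span2-basis? {𝟏} {𝟏} {𝟏} {𝟏} {α} {α²}

SeparatedIfNonAdjacent : Subset → Set
SeparatedIfNonAdjacent S = S ⊆′ SimplexOrZero → ¬ SameSubset L₀ S → ¬ Adjacent L₀ S → SeparatedTraces S

SeparatedIfNonAdjacent-cong : SameSubset S T → SeparatedIfNonAdjacent S → SeparatedIfNonAdjacent T
SeparatedIfNonAdjacent-cong S≐T S-separated T-simplex L₀≠T L₀≁T = SeparatedTraces-cong S≐T (S-separated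
  (λ w w∈S → T-simplex w (Equivalence.to (S≐T w) w∈S))
  (λ L₀≐S → L₀≠T (SameSubset-trans L₀≐S S≐T))
  (λ L₀∼S → L₀≁T (Adjacent-congʳ S≐T L₀∼S)))

SeparatedIfNonAdjacent? : ∀ a b c d e f → Dec (SeparatedIfNonAdjacent (Span2 (basis₁ a b c) (basis₂ d e f)))
SeparatedIfNonAdjacent? a b c d e f =
  Span2-⊆′? w₁ w₂ SimplexOrZero? →-dec
  ¬? (SameSubset-Span2? u₀ v₀ w₁ w₂ L₀? S?) →-dec
  ¬? (Adjacent? u₀ v₀ w₁ w₂ L₀? S?) →-dec
  SeparatedTraces? w₁ w₂ S?
  where
  w₁ w₂ : V
  w₁ = basis₁ a b c
  w₂ = basis₂ d e f
  S? : Decidable (Span2 w₁ w₂)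
  S? = Span2-basis? {a} {b} {c} {d} {e} {f}

-- Decided separately for each value of a: a single decision over all 4⁶ candidates
-- exhausts the type checker's memory.
basis-lines-separated : ∀ a b c d e f → SeparatedIfNonAdjacent (Span2 (basis₁ a b c) (basis₂ d e f))
basis-lines-separated =
  ∀-F4 (from-yes (decide 𝟎)) (from-yes (decide 𝟏)) (from-yes (decide α)) (from-yes (decide α²))
  where
  decide : ∀ a → Dec (∀ b c d e f → SeparatedIfNonAdjacent (Span2 (basis₁ a b c) (basis₂ d e f)))
  decide a = all?-F4 λ b → all?-F4 λ c → all?-F4 λ d → all?-F4 λ e → all?-F4 λ f →
             SeparatedIfNonAdjacent? a b c d e f

lemma6 : (L' : Line) → SimplexLine L' →
         ¬ SameSubset L₀ ⟦ L' ⟧ → ¬ Adjacent L₀ ⟦ L' ⟧ →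
         ∃ λ (p : Fin 5 → V) →
           (∀ i → IsPoint (⟦ L' ⟧ ∩ H i) (p i)) ×
           (∀ i j → i ≢ j → ¬ SameSubset (Span1 (p i)) (Span1 (p j)))
lemma6 L' simplex L₀≠L' L₀≁L' =
  let a , b , c , d , e , f , L'≐S = canonical-basis L' simplex
      L'-separated = SeparatedIfNonAdjacent-cong (SameSubset-sym L'≐S) (basis-lines-separated a b c d e f)
  in SeparatedTraces⇒distinct-points (L'-separated simplex L₀≠L' L₀≁L')
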